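{- Let $\mathcal{M}=(E,\mathcal{L})$ be a simple oriented matroid, let $X\in L(\mathcal{M})$ be a modular flat, and let $\sigma,\tau\in\mathcal{L}$ with $z(\sigma)=z(\tau)=Y\in L(\mathcal{M})$ and $\sigma|_X=\tau|_X$. Then $\sigma|_{X\vee Y}=\tau|_{X\vee Y}$.
   Context: For sign vectors: $(\sigma\circ\tau)_e=\sigma_e$ if $\sigma_e\ne0$, else $\tau_e$; $S(\sigma,\tau)=\{e\mid\sigma_e=-\tau_e\ne0\}$; $z(\sigma)=\{e\mid\sigma_e=0\}$; $\sigma|_A$ is restriction to $A$. An oriented matroid $\mathcal{M}=(E,\mathcal{L})$ is a finite $E$ with $\mathcal{L}\subseteq\{+,-,0\}^E$ such that $\mathbf0\in\mathcal{L}$, $-\mathcal{L}=\mathcal{L}$, $\mathcal{L}$ closed under $\circ$, and for $\sigma,\tau\in\mathcal{L}$, $e\in S(\sigma,\tau)$ there is $\eta\in\mathcal{L}$ with $\eta_e=0$, $\eta_f=(\sigma\circ\tau)_f=(\tau\circ\sigma)_f$ for $f\notin S(\sigma,\tau)$. Simple: no loops (elements $e$ with $\sigma_e=0$ for all $\sigma$) and no parallel pairs. Flats $L(\mathcal{M})=\{z(\sigma)\mid\sigma\in\mathcal{L}\}$ ordered by inclusion, with meet $\cap$ and join $X\vee Y$ the smallest flat containing $X\cup Y$. A flat $X$ is modular if $Z\vee(X\wedge Y)=(Z\vee X)\wedge Y$ for all flats $Z\le Y$. -}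

module Defs where

open import Data.Nat using (ℕ)
open import Data.Fin using (Fin)
open import Data.Fin.Subset using (Subset; _∈_; _∉_; _⊆_; _∩_; _∪_; inside; outside)
open import Data.Vec using (Vec; lookup; map; zipWith; replicate)
open import Data.Product using (Σ; _×_; ∃)
open import Data.Sum using (_⊎_)
open import Relation.Binary.PropositionalEquality using (_≡_; _≢_)
open import Relation.Nullary using (¬_)
open import Function.Bundles using (_⇔_)

data Sign : Set where
  plus minus zer : Sign

negS : Sign → Sign
negS plus  = minus
negS minus = plus
negS zer   = zer

SignVec : ℕ → Set
SignVec n = Vec Sign n

neg : ∀ {n} → SignVec n → SignVec n
neg = map negS

compS : Sign → Sign → Sign
compS zer t = t
compS s   t = s

_⊙_ : ∀ {n} → SignVec n → SignVec n → SignVec n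
σ ⊙ τ = zipWith compS σ τ

zeroVec : ∀ {n} → SignVec n
zeroVec = replicate _ zer

InSep : ∀ {n} → SignVec n → SignVec n → Fin n → Set
InSep σ τ e = (lookup σ e ≡ negS (lookup τ e)) × (lookup σ e ≢ zer)

isZ : Sign → Data.Fin.Subset.Side
isZ zer = inside
isZ _   = outside

z : ∀ {n} → SignVec n → Subset n
z = map isZ

-- oriented matroid on E = Fin n given by its covector set ℒ (a predicate)
record IsOrientedMatroid {n : ℕ} (ℒ : SignVec n → Set) : Set where
  field
    zero∈   : ℒ zeroVec
    neg∈    : ∀ σ → ℒ σ → ℒ (neg σ)
    comp∈   : ∀ σ τ → ℒ σ → ℒ τ → ℒ (σ ⊙ τ)
    elim    : ∀ σ τ → ℒ σ → ℒ τ → ∀ e → InSep σ τ e →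
              Σ (SignVec n) λ η → ℒ η × (lookup η e ≡ zer) ×
                (∀ f → ¬ InSep σ τ f →
                   (lookup η f ≡ lookup (σ ⊙ τ) f) × (lookup η f ≡ lookup (τ ⊙ σ) f))

IsLoop : ∀ {n} → (SignVec n → Set) → Fin n → Set
IsLoop ℒ e = ∀ σ → ℒ σ → lookup σ e ≡ zer

-- e, f parallel: distinct non-loops lying in exactly the same flats
-- (i.e. f ∈ cl{e} and e ∈ cl{f})
IsParallel : ∀ {n} → (SignVec n → Set) → Fin n → Fin n → Set
IsParallel ℒ e f = (e ≢ f) × ¬ IsLoop ℒ e × ¬ IsLoop ℒ f ×
  (∀ σ → ℒ σ → (lookup σ e ≡ zer) ⇔ (lookup σ f ≡ zer))

IsSimple : ∀ {n} → (SignVec n → Set) → Set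
IsSimple ℒ = (∀ e → ¬ IsLoop ℒ e) × (∀ e f → ¬ IsParallel ℒ e f)

IsFlat : ∀ {n} → (SignVec n → Set) → Subset n → Set
IsFlat {n} ℒ X = Σ (SignVec n) λ σ → ℒ σ × (z σ ≡ X)

IsJoin : ∀ {n} → (SignVec n → Set) → Subset n → Subset n → Subset n → Set
IsJoin ℒ X Y J = IsFlat ℒ J × ((X ∪ Y) ⊆ J) ×
  (∀ F → IsFlat ℒ F → (X ∪ Y) ⊆ F → J ⊆ F)

-- modular flat: Z ∨ (X ∧ Y) = (Z ∨ X) ∧ Y for all flats Z ≤ Y (meet = ∩)
IsModular : ∀ {n} → (SignVec n → Set) → Subset n → Set
IsModular ℒ X = IsFlat ℒ X × (∀ Z Y → IsFlat ℒ Z → IsFlat ℒ Y → Z ⊆ Y →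
  ∀ J₁ J₂ → IsJoin ℒ Z (X ∩ Y) J₁ → IsJoin ℒ Z X J₂ → J₁ ≡ J₂ ∩ Y)

RestrEq : ∀ {n} → Subset n → SignVec n → SignVec n → Set
RestrEq A σ τ = ∀ e → e ∈ A → lookup σ e ≡ lookup τ e

-- If σ and τ disagree at some e ∈ X ∨ Y, both being zero exactly on Y, they
-- have opposite nonzero signs there; eliminating e gives a covector η whose
-- zero flat F contains Y and meets X only inside Y (σ = τ on X).  Modularity
-- of X, applied to Y ≤ F, yields (X ∨ Y) ∧ F = Y ∨ (X ∧ F) = Y, so e ∈ Y,
-- contradicting σ_e ≠ 0.
module Submission where

open import Defs
open import Data.Nat using (ℕ)
open import Data.Fin using (Fin)
open import Data.Fin.Subset using (Subset; _∈_; _⊆_; _∩_; inside)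
open import Data.Fin.Subset.Properties using (x∈p∩q⁺; x∈p∩q⁻; x∈p∪q⁻; p⊆p∪q; ∪-comm)
open import Data.Vec using (lookup)
open import Data.Vec.Properties using (lookup⇒[]=; []=⇒lookup; lookup-map; lookup-zipWith)
open import Data.Product using (Σ; _×_; _,_; proj₁; proj₂)
open import Data.Sum using ([_,_])
open import Data.Empty using (⊥-elim)
open import Function using (id; _∘_)
open import Relation.Nullary using (¬_)
open import Relation.Binary.PropositionalEquality
  using (_≡_; _≢_; refl; sym; trans; cong; cong₂; subst)

private
  variable
    n : ℕ

SepSign : Sign → Sign → Set
SepSign s t = (s ≡ negS t) × (s ≢ zer)

¬SepSign-refl : ∀ s → ¬ SepSign s s
¬SepSign-refl plus  (() , _)
¬SepSign-refl minus (() , _)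
¬SepSign-refl zer   (_ , zer≢zer) = zer≢zer refl

sameZero-¬SepSign⇒≡ : ∀ s t → isZ s ≡ isZ t → ¬ SepSign s t → s ≡ t
sameZero-¬SepSign⇒≡ plus  plus  _ _    = refl
sameZero-¬SepSign⇒≡ minus minus _ _    = refl
sameZero-¬SepSign⇒≡ zer   zer   _ _    = refl
sameZero-¬SepSign⇒≡ plus  minus _ ¬sep = ⊥-elim (¬sep (refl , λ ()))
sameZero-¬SepSign⇒≡ minus plus  _ ¬sep = ⊥-elim (¬sep (refl , λ ()))
sameZero-¬SepSign⇒≡ plus  zer   ()
sameZero-¬SepSign⇒≡ minus zer   ()
sameZero-¬SepSign⇒≡ zer   plus  ()
sameZero-¬SepSign⇒≡ zer   minus ()

compS≡zer⇒≡zer : ∀ s t → compS s t ≡ zer → s ≡ zer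
compS≡zer⇒≡zer zer   _ _ = refl
compS≡zer⇒≡zer plus  _ ()
compS≡zer⇒≡zer minus _ ()

isZ≡inside⇒≡zer : ∀ s → isZ s ≡ inside → s ≡ zer
isZ≡inside⇒≡zer zer   _ = refl
isZ≡inside⇒≡zer plus  ()
isZ≡inside⇒≡zer minus ()

lookup-z : (σ : SignVec n) (e : Fin n) → lookup (z σ) e ≡ isZ (lookup σ e)
lookup-z σ e = lookup-map e isZ σ

∈z⇒≡zer : (σ : SignVec n) {e : Fin n} → e ∈ z σ → lookup σ e ≡ zer
∈z⇒≡zer σ {e} e∈zσ = isZ≡inside⇒≡zer _ (trans (sym (lookup-z σ e)) ([]=⇒lookup e∈zσ))

≡zer⇒∈z : (σ : SignVec n) {e : Fin n} → lookup σ e ≡ zer → e ∈ z σ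
≡zer⇒∈z σ {e} σe≡zer = lookup⇒[]= e (z σ) (trans (lookup-z σ e) (cong isZ σe≡zer))

lookup-⊙ : (σ τ : SignVec n) (e : Fin n) → lookup (σ ⊙ τ) e ≡ compS (lookup σ e) (lookup τ e)
lookup-⊙ σ τ e = lookup-zipWith compS e σ τ

sameZeros-¬InSep⇒≡ : {σ τ : SignVec n} {e : Fin n} → z σ ≡ z τ → ¬ InSep σ τ e →
                     lookup σ e ≡ lookup τ e
sameZeros-¬InSep⇒≡ {σ = σ} {τ} {e} zσ≡zτ =
  sameZero-¬SepSign⇒≡ (lookup σ e) (lookup τ e)
    (trans (sym (lookup-z σ e)) (trans (cong (λ v → lookup v e) zσ≡zτ) (lookup-z τ e)))

IsJoin-comm : ∀ {ℒ : SignVec n → Set} {X Y J} → IsJoin ℒ X Y J → IsJoin ℒ Y X J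
IsJoin-comm {X = X} {Y} (flJ , X∪Y⊆J , least) =
  flJ , subst (_⊆ _) (∪-comm X Y) X∪Y⊆J ,
  λ F flF Y∪X⊆F → least F flF (subst (_⊆ F) (∪-comm Y X) Y∪X⊆F)

IsJoin-absorb : ∀ {ℒ : SignVec n → Set} {Y A} → IsFlat ℒ Y → A ⊆ Y → IsJoin ℒ Y A Y
IsJoin-absorb {Y = Y} {A} flY A⊆Y =
  flY , (λ {x} x∈Y∪A → [ id , A⊆Y ] (x∈p∪q⁻ Y A x∈Y∪A)) ,
  λ F _ Y∪A⊆F → Y∪A⊆F ∘ p⊆p∪q A

modular-join-∩ : ∀ {ℒ : SignVec n → Set} {X Y F J} → IsModular ℒ X →
  IsFlat ℒ Y → IsFlat ℒ F → Y ⊆ F → X ∩ F ⊆ Y → IsJoin ℒ X Y J → Y ≡ J ∩ F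
modular-join-∩ {Y = Y} {F} {J} (_ , modular) flY flF Y⊆F X∩F⊆Y X∨Y≡J =
  modular Y F flY flF Y⊆F Y J (IsJoin-absorb flY X∩F⊆Y) (IsJoin-comm X∨Y≡J)

module _ {ℒ : SignVec n → Set} (om : IsOrientedMatroid ℒ) where
  open IsOrientedMatroid om

  separating-flat : ∀ {σ τ} → ℒ σ → ℒ τ → z σ ≡ z τ → ∀ {e} → InSep σ τ e →
    Σ (Subset n) λ F → IsFlat ℒ F × e ∈ F × z σ ⊆ F ×
      (∀ {f} → lookup σ f ≡ lookup τ f → f ∈ F → f ∈ z σ)
  separating-flat {σ} {τ} ℒσ ℒτ zσ≡zτ {e} sep with elim σ τ ℒσ ℒτ e sep
  ... | η , ℒη , ηe≡zer , η-off-sep =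
    z η , (η , ℒη , refl) , ≡zer⇒∈z η ηe≡zer , zσ⊆zη , agree∩zη⊆zσ
    where
    η≡σ⊙τ : ∀ {f} → ¬ InSep σ τ f → lookup η f ≡ compS (lookup σ f) (lookup τ f)
    η≡σ⊙τ {f} ¬sep = trans (proj₁ (η-off-sep f ¬sep)) (lookup-⊙ σ τ f)

    zσ⊆zη : z σ ⊆ z η
    zσ⊆zη {f} f∈zσ = ≡zer⇒∈z η (trans (η≡σ⊙τ λ (_ , σf≢zer) → σf≢zer σf≡zer)
                                      (cong₂ compS σf≡zer τf≡zer))
      where
      σf≡zer = ∈z⇒≡zer σ f∈zσ
      τf≡zer = ∈z⇒≡zer τ (subst (f ∈_) zσ≡zτ f∈zσ)

    agree∩zη⊆zσ : ∀ {f} → lookup σ f ≡ lookup τ f → f ∈ z η → f ∈ z σ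
    agree∩zη⊆zσ {f} σf≡τf f∈zη =
      ≡zer⇒∈z σ (compS≡zer⇒≡zer _ _ (trans (sym (η≡σ⊙τ ¬sep)) (∈z⇒≡zer η f∈zη)))
      where
      ¬sep : ¬ InSep σ τ f
      ¬sep = subst (λ t → ¬ SepSign (lookup σ f) t) σf≡τf (¬SepSign-refl (lookup σ f))

lemma3p3 : (n : ℕ) (ℒ : SignVec n → Set) → IsOrientedMatroid ℒ → IsSimple ℒ →
    (X : Subset n) → IsModular ℒ X →
    (σ τ : SignVec n) → ℒ σ → ℒ τ →
    (Y : Subset n) → z σ ≡ Y → z τ ≡ Y → RestrEq X σ τ →
    (J : Subset n) → IsJoin ℒ X Y J → RestrEq J σ τ
lemma3p3 n ℒ om _ X modX σ τ ℒσ ℒτ .(z σ) refl zτ≡zσ σ≡τ-on-X J X∨Y≡J e e∈J =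
  sameZeros-¬InSep⇒≡ (sym zτ≡zσ) ¬sep
  where
  ¬sep : ¬ InSep σ τ e
  ¬sep sep with separating-flat om ℒσ ℒτ (sym zτ≡zσ) sep
  ... | F , flF , e∈F , zσ⊆F , agree∩F⊆zσ = proj₂ sep (∈z⇒≡zer σ e∈zσ)
    where
    X∩F⊆zσ : X ∩ F ⊆ z σ
    X∩F⊆zσ f∈X∩F with x∈p∩q⁻ X F f∈X∩F
    ... | f∈X , f∈F = agree∩F⊆zσ (σ≡τ-on-X _ f∈X) f∈F

    zσ≡J∩F : z σ ≡ J ∩ F
    zσ≡J∩F = modular-join-∩ modX (σ , ℒσ , refl) flF zσ⊆F X∩F⊆zσ X∨Y≡J

    e∈zσ : e ∈ z σ
    e∈zσ = subst (e ∈_) (sym zσ≡J∩F) (x∈p∩q⁺ (e∈J , e∈F))
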